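{- For every integer $n\ge 2$ there are infinitely many faithful $n$-color fair games, i.e. infinitely many tuples $(a_1,\dots,a_n)$ of positive integers satisfying $\binom{\sum_{i=1}^n a_i}{2}=2\sum_{i=1}^n\binom{a_i}{2}$.
   Context: An $n$-color fair game is a tuple of non-negative integers $(x_1,\dots,x_n)$ satisfying $\binom{\sum_{i} x_i}{2}=2\sum_{i}\binom{x_i}{2}$, equivalently $\left(\sum_i x_i\right)^2-\sum_i x_i-4\sum_{1\le i<j\le n}x_ix_j=0$. A game is faithful if all its coordinates are positive. -}

module Defs where

open import Data.Nat using (ℕ; _*_; _<_)
open import Data.Nat.Combinatorics using (_C_)
open import Data.Vec using (Vec; sum; map)
open import Data.Vec.Relation.Unary.All using (All)
open import Relation.Binary.PropositionalEquality using (_≡_)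

FairGame : {n : ℕ} → Vec ℕ n → Set
FairGame x = (sum x) C 2 ≡ 2 * sum (map (_C 2) x)

Faithful : {n : ℕ} → Vec ℕ n → Set
Faithful x = All (0 <_) x

-- Prepending x to a fair game v keeps it fair exactly when x * Σv = C(x,2), which holds for
-- x = 2Σv + 1.  So every fair pair extends to fair games with any number of colours, and the
-- pairs (C(k,2) + k, C(k,2)) are fair; their entries are positive for k ≥ 2 and their sums grow
-- with k, so choosing k beyond the sums of a given finite list produces a game outside it.
module Submission where

open import Defs
open import Data.Nat using (ℕ; zero; suc; _+_; _*_; _≤_; _<_; z≤n; s≤s)
open import Data.Nat.Properties
open import Data.Nat.Combinatorics using (_C_; nC1≡n; nCk+nC[k+1]≡[n+1]C[k+1])
open import Data.Nat.Tactic.RingSolver using (solve-∀)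
open import Data.Vec using (Vec; []; _∷_; sum; map)
open import Data.Vec.Relation.Unary.All using ([]; _∷_)
open import Data.List using (List; []; _∷_)
import Data.List.Base as List using (map)
import Data.Nat.ListAction as List
open import Data.List.Membership.Propositional using (_∈_; _∉_)
open import Data.List.Membership.Propositional.Properties using (∈-map⁺)
open import Data.List.Relation.Unary.Any using (here; there)
open import Data.Product using (∃; _×_; _,_)
open import Relation.Binary.PropositionalEquality
open ≡-Reasoning

[1+n]C2≡n+nC2 : ∀ m → suc m C 2 ≡ m + m C 2
[1+n]C2≡n+nC2 m = begin
  suc m C 2      ≡⟨ nCk+nC[k+1]≡[n+1]C[k+1] m 1 ⟨
  m C 1 + m C 2  ≡⟨ cong (_+ m C 2) (nC1≡n m) ⟩
  m + m C 2      ∎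

[m+n]C2≡mC2+nC2+m*n : ∀ a b → (a + b) C 2 ≡ a C 2 + b C 2 + a * b
[m+n]C2≡mC2+nC2+m*n zero    b = sym (+-identityʳ (b C 2))
[m+n]C2≡mC2+nC2+m*n (suc a) b = begin
  suc (a + b) C 2                    ≡⟨ [1+n]C2≡n+nC2 (a + b) ⟩
  (a + b) + (a + b) C 2              ≡⟨ cong ((a + b) +_) ([m+n]C2≡mC2+nC2+m*n a b) ⟩
  (a + b) + (a C 2 + b C 2 + a * b)  ≡⟨ rearrange a b (a C 2) (b C 2) ⟩
  (a + a C 2) + b C 2 + suc a * b    ≡⟨ cong (λ c → c + b C 2 + suc a * b) ([1+n]C2≡n+nC2 a) ⟨
  suc a C 2 + b C 2 + suc a * b      ∎
  where
  rearrange : ∀ a b c d → (a + b) + (c + d + a * b) ≡ (a + c) + d + suc a * b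
  rearrange = solve-∀

2*nC2+n≡n*n : ∀ m → 2 * (m C 2) + m ≡ m * m
2*nC2+n≡n*n zero    = refl
2*nC2+n≡n*n (suc m) = begin
  2 * (suc m C 2) + suc m          ≡⟨ cong (λ c → 2 * c + suc m) ([1+n]C2≡n+nC2 m) ⟩
  2 * (m + m C 2) + suc m          ≡⟨ rearrange m (m C 2) ⟩
  (2 * (m C 2) + m) + (2 * m + 1)  ≡⟨ cong (_+ (2 * m + 1)) (2*nC2+n≡n*n m) ⟩
  m * m + (2 * m + 1)              ≡⟨ square m ⟩
  suc m * suc m                    ∎
  where
  rearrange : ∀ m c → 2 * (m + c) + suc m ≡ (2 * c + m) + (2 * m + 1)
  rearrange = solve-∀
  square : ∀ m → m * m + (2 * m + 1) ≡ suc m * suc m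
  square = solve-∀

-- C(m,2) is pinned down by 2·C(m,2) + m = m², and m = 2s + 1 makes m² = 2·(m·s) + m.
[1+2n]C2≡[1+2n]*n : ∀ s → suc (2 * s) C 2 ≡ suc (2 * s) * s
[1+2n]C2≡[1+2n]*n s = *-cancelˡ-≡ (m C 2) (m * s) 2 (+-cancelʳ-≡ m _ _ (begin
  2 * (m C 2) + m  ≡⟨ 2*nC2+n≡n*n m ⟩
  m * m            ≡⟨ expand s ⟩
  2 * (m * s) + m  ∎))
  where
  m : ℕ
  m = suc (2 * s)
  expand : ∀ s → suc (2 * s) * suc (2 * s) ≡ 2 * (suc (2 * s) * s) + suc (2 * s)
  expand = solve-∀

0<[2+n]C2 : ∀ d → 0 < suc (suc d) C 2
0<[2+n]C2 d = subst (0 <_) (sym ([1+n]C2≡n+nC2 (suc d))) (s≤s z≤n)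

fair-pair : ∀ x y → x * y ≡ x C 2 + y C 2 → FairGame (x ∷ y ∷ [])
-- The rewrites remove the trailing + 0 that Vec.sum leaves on a pair.
fair-pair x y xy≡ rewrite +-identityʳ y | +-identityʳ (y C 2) = begin
  (x + y) C 2                      ≡⟨ [m+n]C2≡mC2+nC2+m*n x y ⟩
  x C 2 + y C 2 + x * y            ≡⟨ cong (x C 2 + y C 2 +_) xy≡ ⟩
  x C 2 + y C 2 + (x C 2 + y C 2)  ≡⟨ double (x C 2 + y C 2) ⟩
  2 * (x C 2 + y C 2)              ∎
  where
  double : ∀ t → t + t ≡ 2 * t
  double = solve-∀

fair-∷ : ∀ {n} x (v : Vec ℕ n) → x * sum v ≡ x C 2 → FairGame v → FairGame (x ∷ v)
fair-∷ x v xS≡ fair = begin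
  (x + sum v) C 2                ≡⟨ [m+n]C2≡mC2+nC2+m*n x (sum v) ⟩
  x C 2 + sum v C 2 + x * sum v  ≡⟨ cong₂ (λ c p → x C 2 + c + p) fair xS≡ ⟩
  x C 2 + 2 * T + x C 2          ≡⟨ collect (x C 2) T ⟩
  2 * (x C 2 + T)                ∎
  where
  T : ℕ
  T = sum (map (_C 2) v)
  collect : ∀ c t → c + 2 * t + c ≡ 2 * (c + t)
  collect = solve-∀

seed : ℕ → Vec ℕ 2
seed k = k C 2 + k ∷ k C 2 ∷ []

seed-fair : ∀ k → FairGame (seed k)
seed-fair k = fair-pair (y + k) y (begin
  (y + k) * y                ≡⟨ *-distribʳ-+ y y k ⟩
  y * y + k * y              ≡⟨ cong (_+ k * y) (2*nC2+n≡n*n y) ⟨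
  2 * (y C 2) + y + k * y    ≡⟨ rearrange (y C 2) y k ⟩
  y C 2 + y + y * k + y C 2  ≡⟨ cong (_+ y C 2) ([m+n]C2≡mC2+nC2+m*n y k) ⟨
  (y + k) C 2 + y C 2        ∎)
  where
  y : ℕ
  y = k C 2
  rearrange : ∀ c y k → 2 * c + y + k * y ≡ c + y + y * k + c
  rearrange = solve-∀

extend : ∀ {n} → Vec ℕ n → Vec ℕ (suc n)
extend v = suc (2 * sum v) ∷ v

extend-fair : ∀ {n} (v : Vec ℕ n) → FairGame v → FairGame (extend v)
extend-fair v = fair-∷ (suc (2 * sum v)) v (sym ([1+2n]C2≡[1+2n]*n (sum v)))

game : ∀ m → ℕ → Vec ℕ (2 + m)
game zero    k = seed k
game (suc m) k = extend (game m k)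

game-fair : ∀ m k → FairGame (game m k)
game-fair zero    k = seed-fair k
game-fair (suc m) k = extend-fair (game m k) (game-fair m k)

game-faithful : ∀ m d → Faithful (game m (suc (suc d)))
game-faithful zero    d = <-≤-trans (0<[2+n]C2 d) (m≤m+n _ _) ∷ 0<[2+n]C2 d ∷ []
game-faithful (suc m) d = s≤s z≤n ∷ game-faithful m d

k≤sum-game : ∀ m k → k ≤ sum (game m k)
k≤sum-game zero    k = ≤-trans (m≤n+m k (k C 2)) (m≤m+n _ _)
k≤sum-game (suc m) k = ≤-trans (k≤sum-game m k) (m≤n+m _ _)

∈⇒≤sum : ∀ {n ns} → n ∈ ns → n ≤ List.sum ns
∈⇒≤sum {ns = n ∷ ns} (here refl)  = m≤m+n n (List.sum ns)
∈⇒≤sum {ns = m ∷ ns} (there n∈ns) = ≤-trans (∈⇒≤sum n∈ns) (m≤n+m _ m)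

theorem3p1 : (n : ℕ) → 2 ≤ n → (L : List (Vec ℕ n)) →
    ∃ λ (a : Vec ℕ n) → Faithful a × FairGame a × a ∉ L
theorem3p1 (suc zero)    (s≤s ()) L
theorem3p1 (suc (suc m)) _        L = a , game-faithful m bound , game-fair m k , a∉L
  where
  bound : ℕ
  bound = List.sum (List.map sum L)
  k : ℕ
  k = suc (suc bound)
  a : Vec ℕ (2 + m)
  a = game m k
  a∉L : a ∉ L
  a∉L a∈L = <⇒≱ (≤-trans (n≤1+n _) (k≤sum-game m k)) (∈⇒≤sum (∈-map⁺ sum a∈L))
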